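{- Let $k\ge 0$ and $n\ge 3k+1$ be integers, and let $w$ be a composition of $n$. Then $w$ is uniquely determined by its set of $k$-deletions: if $w'$ is any composition whose set of $k$-deletions equals the set of $k$-deletions of $w$, then $w'=w$.
   Context: A composition is a finite word $w=w(1)w(2)\cdots w(m)$ whose letters are positive integers; it is a composition of $n$ if $w(1)+\cdots+w(m)=n$. A $1$-deletion of $w$ is a composition obtained from $w$ either by lowering an entry that is $\ge 2$ by $1$, or by removing an entry equal to $1$. For $k\ge 0$, the $k$-deletions of $w$ are defined recursively: the only $0$-deletion of $w$ is $w$ itself, and a $k$-deletion is a $1$-deletion of a $(k-1)$-deletion. Thus the $k$-deletions of a composition of $n$ are compositions of $n-k$. -}

module Defs where

open import Data.Nat using (ℕ; zero; suc; _≤_)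
open import Data.List using (List; []; _∷_)
open import Data.List.Relation.Unary.All using (All)

IsComposition : List ℕ → Set
IsComposition w = All (1 ≤_) w

data Del1 : List ℕ → List ℕ → Set where
  lower  : ∀ {a} xs → Del1 (suc (suc a) ∷ xs) (suc a ∷ xs)
  remove : ∀ xs → Del1 (1 ∷ xs) xs
  skip   : ∀ {x xs ys} → Del1 xs ys → Del1 (x ∷ xs) (x ∷ ys)

data DelK : ℕ → List ℕ → List ℕ → Set where
  zero : ∀ {w} → DelK zero w w
  step : ∀ {k w v u} → DelK k w v → Del1 v u → DelK (suc k) w u

{-# OPTIONS --safe #-}
-- For compositions, u is a k-deletion of w exactly when u ≼ w (u is a subsequence of w with
-- some entries lowered) and sum u + k = sum w; stopping a deletion chain early shows that every
-- v ≼ w with sum v + k ≤ sum w lies below a k-deletion of w.  So compositions w, w′ of n with the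
-- same k-deletions have the same subcompositions of size at most n − k, and for n ≥ 3k + 1 these
-- determine w.  The lengths agree: compare 1^|w′|, or, when w′ has excess below k, a light
-- subcomposition of w of larger excess.  At the first position where w = l x r and w′ = l x′ r′
-- differ, say x′ < x, either x′ > k, and lowering x (resp. x′) by k gives full-length
-- subcompositions forcing r = r′ and then x = x′; or x′ ≤ k, and the threshold a = x′ + 1 is
-- detected by 1…1 a 1…1 when w has large excess, and otherwise by counting the entries ≥ a
-- before and after that position.

module Submission where

open import Defs
open import Data.Nat using (ℕ; _≤_; _*_; _+_)
open import Data.List using (List)
open import Data.Nat.ListAction using (sum)
open import Data.Product using (_×_)
open import Relation.Binary.PropositionalEquality using (_≡_)

open import Data.Nat using (zero; suc; pred; _∸_; _<_; _≤′_; ≤′-refl; ≤′-step; z≤n; s≤s; s≤s⁻¹; _≤?_; _≟_)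
open import Data.Nat.Properties
open import Data.Nat.ListAction.Properties using (sum-++)
open import Data.Nat.Tactic.RingSolver using (solve-∀)
open import Data.List using ([]; _∷_; _++_; [_]; length; replicate; filter; reverse; map)
open import Data.List.Properties
  using (length-++; length-replicate; ++-assoc; filter-++; filter-all; filter-accept; filter-reject; reverse-++; length-reverse)
open import Data.List.Relation.Unary.All using (All; []; _∷_; head; tail)
import Data.List.Relation.Unary.All.Properties as All
open import Data.List.Relation.Binary.Pointwise as Pointwise using (Pointwise; []; _∷_; Pointwise-≡⇒≡)
import Data.List.Relation.Binary.Pointwise.Properties as Pointwise
open import Data.List.Relation.Binary.Sublist.Heterogeneous using (Sublist; []; _∷_; _∷ʳ_; minimum)
import Data.List.Relation.Binary.Sublist.Heterogeneous.Properties as Sublist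
open import Data.Product using (∃; _,_; proj₁; proj₂)
open import Data.Sum as Sum using (_⊎_; inj₁; inj₂)
open import Data.Empty using (⊥; ⊥-elim)
open import Relation.Nullary using (¬_; yes; no)
open import Relation.Binary using (tri<; tri≈; tri>; DecidableEquality)
open import Function using (_∘_)
open import Relation.Binary.PropositionalEquality using (_≢_; refl; sym; trans; cong; cong₂; subst; subst₂; module ≡-Reasoning)

-- Deletions and dominated subsequences

infix 4 _≼_

_≼_ : List ℕ → List ℕ → Set
_≼_ = Sublist _≤_

≼-refl : ∀ {w} → w ≼ w
≼-refl = Sublist.refl ≤-refl

≼-trans : ∀ {u v w} → u ≼ v → v ≼ w → u ≼ w
≼-trans = Sublist.trans ≤-trans

Del1⇒≼ : ∀ {w u} → Del1 w u → u ≼ w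
Del1⇒≼ (lower xs)  = n≤1+n _ ∷ ≼-refl
Del1⇒≼ (remove xs) = 1 ∷ʳ ≼-refl
Del1⇒≼ (skip d)    = ≤-refl ∷ Del1⇒≼ d

Del1-sum : ∀ {w u} → Del1 w u → sum w ≡ suc (sum u)
Del1-sum (lower xs)  = refl
Del1-sum (remove xs) = refl
Del1-sum {x ∷ _} {_ ∷ u} (skip d) = trans (cong (x +_) (Del1-sum d)) (+-suc x (sum u))

DelK⇒≼ : ∀ {k w u} → DelK k w u → u ≼ w
DelK⇒≼ zero       = ≼-refl
DelK⇒≼ (step d e) = ≼-trans (Del1⇒≼ e) (DelK⇒≼ d)

DelK-sum : ∀ {k w u} → DelK k w u → sum w ≡ k + sum u
DelK-sum zero = refl
DelK-sum {suc k} {u = u} (step d e) =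
  trans (DelK-sum d) (trans (cong (k +_) (Del1-sum e)) (+-suc k (sum u)))

DelK-trans : ∀ {i j w v u} → DelK i w v → DelK j v u → DelK (j + i) w u
DelK-trans d zero       = d
DelK-trans d (step e f) = step (DelK-trans d e) f

DelK-cons : ∀ {k w u} x → DelK k w u → DelK k (x ∷ w) (x ∷ u)
DelK-cons x zero       = zero
DelK-cons x (step d e) = step (DelK-cons x d) (skip e)

DelK-lower : ∀ {a y} xs → a ≤′ y → ∃ λ d → DelK d (suc y ∷ xs) (suc a ∷ xs)
DelK-lower xs ≤′-refl = 0 , zero
DelK-lower xs (≤′-step a≤′y) =
  let d , del = DelK-lower xs a≤′y in d + 1 , DelK-trans (step zero (lower xs)) del

≼⇒DelK : ∀ {u w} → IsComposition u → IsComposition w → u ≼ w → ∃ λ j → DelK j w u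
≼⇒DelK [] [] [] = 0 , zero
≼⇒DelK cu (s≤s _ ∷ cw) (_ ∷ʳ u≼w) =
  let j , del = ≼⇒DelK cu cw u≼w
      d , lowered = DelK-lower _ z≤′n
  in j + suc d , DelK-trans (step lowered (remove _)) del
≼⇒DelK (s≤s _ ∷ cu) (_ ∷ cw) (s≤s a≤y ∷ u≼w) =
  let j , del = ≼⇒DelK cu cw u≼w
      d , lowered = DelK-lower _ (≤⇒≤′ a≤y)
  in d + j , DelK-trans (DelK-cons _ del) lowered

DelK-factor : ∀ {k j w v} → k ≤′ j → DelK j w v → ∃ λ u → DelK k w u × v ≼ u
DelK-factor ≤′-refl d = _ , d , ≼-refl
DelK-factor (≤′-step k≤′j) (step d e) =
  let u , d′ , v′≼u = DelK-factor k≤′j d in u , d′ , ≼-trans (Del1⇒≼ e) v′≼u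

Inherits : ℕ → ℕ → List ℕ → List ℕ → Set
Inherits k n w w′ = ∀ {v} → IsComposition v → sum v + k ≤ n → v ≼ w → v ≼ w′

deletions-inherit : ∀ {k w w′} → IsComposition w → (∀ u → DelK k w u → DelK k w′ u) →
                    Inherits k (sum w) w w′
deletions-inherit {k} cw H {v} cv small v≼w with ≼⇒DelK cv cw v≼w
... | j , del = let u , d , v≼u = DelK-factor (≤⇒≤′ k≤j) del in ≼-trans v≼u (DelK⇒≼ (H u d))
  where
  k≤j : k ≤ j
  k≤j = +-cancelˡ-≤ (sum v) k j (subst (sum v + k ≤_) (trans (DelK-sum del) (+-comm j (sum v))) small)

DelK-exists : ∀ {k w} → IsComposition w → k ≤ sum w → ∃ λ u → DelK k w u
DelK-exists {k} {w} cw k≤ =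
  let j , del = ≼⇒DelK [] cw (minimum w)
      u , d , _ = DelK-factor (≤⇒≤′ (subst (k ≤_) (trans (DelK-sum del) (+-identityʳ j)) k≤)) del
  in u , d

record Indistinguishable (k n : ℕ) (w w′ : List ℕ) : Set where
  field
    composition  : IsComposition w
    composition′ : IsComposition w′
    sum≡  : sum w ≡ n
    sum≡′ : sum w′ ≡ n
    inherit  : Inherits k n w w′
    inherit′ : Inherits k n w′ w

swap : ∀ {k n w w′} → Indistinguishable k n w w′ → Indistinguishable k n w′ w
swap I = record
  { composition = composition′ ; composition′ = composition
  ; sum≡ = sum≡′ ; sum≡′ = sum≡ ; inherit = inherit′ ; inherit′ = inherit }
  where open Indistinguishable I

same-deletions⇒indistinguishable :
  ∀ {k n w w′} → k ≤ n → IsComposition w → sum w ≡ n → IsComposition w′ →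
  (∀ u → (DelK k w u → DelK k w′ u) × (DelK k w′ u → DelK k w u)) →
  Indistinguishable k n w w′
same-deletions⇒indistinguishable {k} {n} {w} {w′} k≤n cw sw cw′ H = record
  { composition = cw ; composition′ = cw′ ; sum≡ = sw ; sum≡′ = sw′
  ; inherit  = subst (λ m → Inherits k m w w′) sw (deletions-inherit cw (proj₁ ∘ H))
  ; inherit′ = subst (λ m → Inherits k m w′ w) sw′ (deletions-inherit cw′ (proj₂ ∘ H)) }
  where
  sw′ : sum w′ ≡ n
  sw′ with DelK-exists cw (subst (k ≤_) (sym sw) k≤n)
  ... | u , d = trans (DelK-sum (proj₁ (H u) d)) (trans (sym (DelK-sum d)) sw)

-- Excess and counting

excess : List ℕ → ℕ
excess w = sum (map pred w)

sum≡length+excess : ∀ {w} → IsComposition w → sum w ≡ length w + excess w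
sum≡length+excess [] = refl
sum≡length+excess {suc x ∷ w} (_ ∷ cw) =
  cong suc (trans (cong (x +_) (sum≡length+excess cw)) (x+y+z≡y+x+z x (length w) (excess w)))
  where
  x+y+z≡y+x+z : ∀ x y z → x + (y + z) ≡ y + (x + z)
  x+y+z≡y+x+z = solve-∀

excess-mono : ∀ {u w} → u ≼ w → excess u ≤ excess w
excess-mono []            = z≤n
excess-mono (y ∷ʳ u≼w)    = ≤-trans (excess-mono u≼w) (m≤n+m _ (pred y))
excess-mono (x≤y ∷ u≼w)   = +-mono-≤ (pred-mono-≤ x≤y) (excess-mono u≼w)

subcomposition-of-excess :
  ∀ {w t} → IsComposition w → t ≤ excess w →
  ∃ λ u → IsComposition u × u ≼ w × excess u ≡ t × length u ≤ t
subcomposition-of-excess [] z≤n = [] , [] , [] , refl , z≤n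
subcomposition-of-excess {suc y ∷ w} {t} (_ ∷ cw) t≤ with t ≤? excess w
... | yes t≤′ =
  let u , cu , u≼w , ex , len = subcomposition-of-excess cw t≤′ in u , cu , _ ∷ʳ u≼w , ex , len
... | no t≰ =
  let u , cu , u≼w , ex , len = subcomposition-of-excess cw ≤-refl
  in suc (t ∸ excess w) ∷ u , s≤s z≤n ∷ cu , s≤s head≤y ∷ u≼w
   , trans (cong (t ∸ excess w +_) ex) (m∸n+n≡m (<⇒≤ e<t)) , ≤-trans (s≤s len) e<t
  where
  e<t : excess w < t
  e<t = ≰⇒> t≰
  head≤y : t ∸ excess w ≤ y
  head≤y = m≤n+o⇒m∸n≤o t (excess w) (subst (t ≤_) (+-comm y (excess w)) t≤)

count≥ : ℕ → List ℕ → ℕ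
count≥ a w = length (filter (a ≤?_) w)

count≥-++ : ∀ a u w → count≥ a (u ++ w) ≡ count≥ a u + count≥ a w
count≥-++ a u w = trans (cong length (filter-++ (a ≤?_) u w)) (length-++ (filter (a ≤?_) u))

count≥-accept : ∀ {a x} w → a ≤ x → count≥ a (x ∷ w) ≡ suc (count≥ a w)
count≥-accept {a} w a≤x = cong length (filter-accept (a ≤?_) a≤x)

count≥-reject : ∀ {a x} w → x < a → count≥ a (x ∷ w) ≡ count≥ a w
count≥-reject {a} w x<a = cong length (filter-reject (a ≤?_) (<⇒≱ x<a))

replicate-≼⇒count≥ : ∀ {j a w} → replicate j a ≼ w → j ≤ count≥ a w
replicate-≼⇒count≥ {j} {a} rep≼w = subst (_≤ _) count-rep
  (Sublist.length-mono-≤ (Sublist.⊆-filter-Sublist (a ≤?_) (a ≤?_) (λ x≤y a≤x → ≤-trans a≤x x≤y) rep≼w))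
  where
  count-rep : count≥ a (replicate j a) ≡ j
  count-rep = trans (cong length (filter-all (a ≤?_) (All.replicate⁺ j ≤-refl))) (length-replicate j)

count≥⇒replicate-≼ : ∀ {j a w} → j ≤ count≥ a w → replicate j a ≼ w
count≥⇒replicate-≼ {zero} _ = minimum _
count≥⇒replicate-≼ {suc j} {a} {x ∷ w} j<c with a ≤? x
... | yes a≤x = a≤x ∷ count≥⇒replicate-≼ (s≤s⁻¹ (subst (suc j ≤_) (count≥-accept w a≤x) j<c))
... | no a≰x = x ∷ʳ count≥⇒replicate-≼ (subst (suc j ≤_) (count≥-reject w (≰⇒> a≰x)) j<c)

excess-count≥ : ∀ s w → s * count≥ (suc s) w ≤ excess w
excess-count≥ s [] = ≤-reflexive (*-zeroʳ s)
excess-count≥ s (x ∷ w) with suc s ≤? x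
... | yes s<x = begin
  s * count≥ (suc s) (x ∷ w) ≡⟨ cong (s *_) (count≥-accept w s<x) ⟩
  s * suc (count≥ (suc s) w) ≡⟨ *-suc s _ ⟩
  s + s * count≥ (suc s) w   ≤⟨ +-mono-≤ (pred-mono-≤ s<x) (excess-count≥ s w) ⟩
  pred x + excess w          ∎
  where open ≤-Reasoning
... | no s≮x = begin
  s * count≥ (suc s) (x ∷ w) ≡⟨ cong (s *_) (count≥-reject w (≰⇒> s≮x)) ⟩
  s * count≥ (suc s) w       ≤⟨ excess-count≥ s w ⟩
  excess w                   ≤⟨ m≤n+m _ (pred x) ⟩
  pred x + excess w          ∎
  where open ≤-Reasoning

ones : ℕ → List ℕ
ones m = replicate m 1

ones-composition : ∀ m → IsComposition (ones m)
ones-composition m = All.replicate⁺ m ≤-refl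

ones-≼ : ∀ {w} → IsComposition w → ones (length w) ≼ w
ones-≼ []        = []
ones-≼ (p ∷ cw) = p ∷ ones-≼ cw

sum-replicate : ∀ j a → sum (replicate j a) ≡ j * a
sum-replicate zero    a = refl
sum-replicate (suc j) a = cong (a +_) (sum-replicate j a)

sum-ones : ∀ m → sum (ones m) ≡ m
sum-ones m = trans (sum-replicate m 1) (*-identityʳ m)

Sublist-++⁻ʳ : ∀ {A B : Set} {R : A → B → Set} {as cs : List A} {bs ds : List B} →
               length cs ≡ length ds → Sublist R (as ++ cs) (bs ++ ds) → Sublist R as bs
Sublist-++⁻ʳ {as = as} {cs} {bs} {ds} len p = Sublist.reverse⁻ (Sublist.++⁻ len′
  (subst₂ (Sublist _) (reverse-++ as cs) (reverse-++ bs ds) (Sublist.reverse⁺ p)))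
  where
  len′ : length (reverse cs) ≡ length (reverse ds)
  len′ = trans (length-reverse cs) (trans len (sym (length-reverse ds)))

record Divergence {A : Set} (xs ys : List A) : Set where
  constructor diverge
  field
    prefix : List A
    x y    : A
    rest rest′ : List A
    x≢y : x ≢ y
    xs≡ : xs ≡ prefix ++ x ∷ rest
    ys≡ : ys ≡ prefix ++ y ∷ rest′

≡-or-divergence : ∀ {A : Set} → DecidableEquality A → ∀ (xs ys : List A) →
                  length xs ≡ length ys → xs ≡ ys ⊎ Divergence xs ys
≡-or-divergence _≟′_ [] [] _ = inj₁ refl
≡-or-divergence _≟′_ (x ∷ xs) (y ∷ ys) len with x ≟′ y
... | no x≢y = inj₂ (diverge [] x y xs ys x≢y refl refl)
... | yes refl with ≡-or-divergence _≟′_ xs ys (suc-injective len)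
...   | inj₁ refl = inj₁ refl
...   | inj₂ (diverge l u v r r′ u≢v refl refl) = inj₂ (diverge (x ∷ l) u v r r′ u≢v refl refl)

≤-or-≤ : ∀ {x y m} → x + y ≤ suc (m + m) → x ≤ m ⊎ y ≤ m
≤-or-≤ {x} {y} {m} bound with x ≤? m
... | yes x≤m = inj₁ x≤m
... | no x≰m = inj₂ (+-cancelˡ-≤ (suc m) y m (begin
  suc m + y ≤⟨ +-monoˡ-≤ y (≰⇒> x≰m) ⟩
  x + y     ≤⟨ bound ⟩
  suc (m + m) ∎))
  where open ≤-Reasoning

count-bound : ∀ {s k t e} → 1 ≤ s → s ≤ k → s * t ≤ e → e < s + k → t + s ≤ suc k
count-bound {suc s} {k} {t} {e} _ s≤k st≤e e<s+k with m≤n⇒∃[o]m+o≡n s≤k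
... | c , refl = subst (t + suc s ≤_) (cong suc (+-comm c (suc s))) (+-monoˡ-≤ (suc s) t≤c+1)
  where
  t≤c+1 : t ≤ suc c
  t≤c+1 = ≮⇒≥ λ c+1<t → <-irrefl refl (begin-strict
    suc s * suc (suc c)   ≤⟨ *-monoʳ-≤ (suc s) c+1<t ⟩
    suc s * t             ≤⟨ st≤e ⟩
    e                     <⟨ e<s+k ⟩
    suc s + (suc s + c)   ≤⟨ +-monoʳ-≤ (suc s) (+-monoʳ-≤ (suc s) (m≤n*m c (suc s))) ⟩
    suc s + (suc s + suc s * c) ≡⟨ cong (suc s +_) (sym (*-suc (suc s) c)) ⟩
    suc s + suc s * suc c ≡⟨ sym (*-suc (suc s) (suc c)) ⟩
    suc s * suc (suc c)   ∎)
    where open ≤-Reasoning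

replicate-fits : ∀ {s k t e L} → t + s ≤ suc k → s * t ≤ e → e < s + k → 3 * k + 1 ≤ L + e →
                 t * suc s + k ≤ L + e
replicate-fits {s} {k} {t} {e} {L} t+s≤ st≤e e<s+k n-large = begin
  t * suc s + k    ≡⟨ rearrange t s k ⟩
  (t + k) + s * t  ≤⟨ +-mono-≤ t+k≤L st≤e ⟩
  L + e            ∎
  where
  open ≤-Reasoning
  rearrange : ∀ t s k → t * suc s + k ≡ (t + k) + s * t
  rearrange = solve-∀
  slack = suc (s + e + k + k)
  lhs : ∀ t k s e → suc (t + k) + suc (s + e + k + k) ≡ (t + s) + suc e + (3 * k + 1)
  lhs = solve-∀
  rhs : ∀ k s L e → suc k + (s + k) + (L + e) ≡ L + suc (s + e + k + k)
  rhs = solve-∀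
  t+k≤L : t + k ≤ L
  t+k≤L = <⇒≤ (+-cancelʳ-≤ slack (suc (t + k)) L (begin
    suc (t + k) + slack            ≡⟨ lhs t k s e ⟩
    (t + s) + suc e + (3 * k + 1)  ≤⟨ +-mono-≤ (+-mono-≤ t+s≤ e<s+k) n-large ⟩
    suc k + (s + k) + (L + e)      ≡⟨ rhs k s L e ⟩
    L + slack                      ∎))

pair-fits : ∀ {s k t e L} → t + s ≤ suc k → s * t ≤ e → 3 * k + 1 ≤ L + e →
            t * suc s + suc s + L + (k + k) ≤ suc ((L + e) + (L + e))
pair-fits {s} {k} {t} {e} {L} t+s≤ st≤e n-large = begin
  t * suc s + suc s + L + (k + k)      ≡⟨ rearrange t s L k ⟩
  (L + s * t) + (suc (t + s) + (k + k)) ≤⟨ +-mono-≤ (+-monoʳ-≤ L st≤e) (+-monoˡ-≤ (k + k) (s≤s t+s≤)) ⟩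
  (L + e) + (suc (suc k) + (k + k))    ≡⟨ cong ((L + e) +_) (three k) ⟩
  (L + e) + suc (3 * k + 1)            ≤⟨ +-monoʳ-≤ (L + e) (s≤s n-large) ⟩
  (L + e) + suc (L + e)                ≡⟨ +-suc (L + e) (L + e) ⟩
  suc ((L + e) + (L + e))              ∎
  where
  open ≤-Reasoning
  rearrange : ∀ t s L k → t * suc s + suc s + L + (k + k) ≡ (L + s * t) + (suc (t + s) + (k + k))
  rearrange = solve-∀
  three : ∀ k → suc (suc k) + (k + k) ≡ suc (3 * k + 1)
  three = solve-∀

-- Reconstruction

module _ {k n w w′} (n-large : 3 * k + 1 ≤ n) (I : Indistinguishable k n w w′) where
  open Indistinguishable I

  private
    n≡ : n ≡ length w + excess w
    n≡ = trans (sym sum≡) (sum≡length+excess composition)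
    n≡′ : n ≡ length w′ + excess w′
    n≡′ = trans (sym sum≡′) (sum≡length+excess composition′)

  excess-≤ : excess w′ < k → excess w ≤ excess w′
  excess-≤ e′<k = ≮⇒≥ λ e′<e →
    let u , cu , u≼w , ex , len = subcomposition-of-excess composition e′<e
        light : sum u + k ≤ n
        light = begin
          sum u + k                  ≡⟨ cong (_+ k) (sum≡length+excess cu) ⟩
          length u + excess u + k    ≤⟨ +-monoˡ-≤ k (+-mono-≤ (≤-trans len e′<k) (≤-trans (≤-reflexive ex) e′<k)) ⟩
          k + k + k                  ≡⟨ k+k+k≡3*k k ⟩
          3 * k                      ≤⟨ m≤m+n (3 * k) 1 ⟩
          3 * k + 1                  ≤⟨ n-large ⟩
          n                          ∎
    in <-irrefl refl (subst (_≤ excess w′) ex (excess-mono (inherit cu light u≼w)))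
    where
    open ≤-Reasoning
    k+k+k≡3*k : ∀ k → k + k + k ≡ 3 * k
    k+k+k≡3*k = solve-∀

  length-≤ : length w′ ≤ length w
  length-≤ with length w′ + k ≤? n
  ... | yes small = subst (_≤ length w) (length-replicate (length w′)) (Sublist.length-mono-≤
        (inherit′ (ones-composition _) (subst (λ m → m + k ≤ n) (sym (sum-ones _)) small) (ones-≼ composition′)))
  ... | no large = +-cancelʳ-≤ (excess w′) (length w′) (length w) (begin
        length w′ + excess w′ ≡⟨ sym n≡′ ⟩
        n                     ≡⟨ n≡ ⟩
        length w + excess w   ≤⟨ +-monoʳ-≤ (length w) (excess-≤ e′<k) ⟩
        length w + excess w′  ∎)
    where
    open ≤-Reasoning
    e′<k : excess w′ < k
    e′<k = +-cancelˡ-< (length w′) _ _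
             (subst (_< length w′ + k) n≡′ (≰⇒> large))

  count≥-≤ : ∀ {s} → 1 ≤ s → s ≤ k → excess w < s + k → count≥ (suc s) w ≤ count≥ (suc s) w′
  count≥-≤ {s} 1≤s s≤k small = replicate-≼⇒count≥
    (inherit (All.replicate⁺ t (s≤s z≤n)) fits (count≥⇒replicate-≼ ≤-refl))
    where
    t = count≥ (suc s) w
    fits : sum (replicate t (suc s)) + k ≤ n
    fits = subst₂ _≤_ (cong (_+ k) (sym (sum-replicate t (suc s)))) (sym n≡)
      (replicate-fits (count-bound 1≤s s≤k (excess-count≥ s w) small) (excess-count≥ s w) small
        (subst (3 * k + 1 ≤_) n≡ n-large))

length-≡ : ∀ {k n w w′} → 3 * k + 1 ≤ n → Indistinguishable k n w w′ → length w ≡ length w′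
length-≡ n-large I = ≤-antisym (length-≤ n-large (swap I)) (length-≤ n-large I)


module _ {k n l x r x′ r′} (n-large : 3 * k + 1 ≤ n)
         (I : Indistinguishable k n (l ++ x ∷ r) (l ++ x′ ∷ r′)) where
  open Indistinguishable I

  private
    w  = l ++ x ∷ r
    w′ = l ++ x′ ∷ r′
    e  = excess w

    length-rest : length r ≡ length r′
    length-rest = suc-injective (+-cancelˡ-≡ (length l) _ _
      (trans (sym (length-++ l)) (trans (length-≡ n-large I) (length-++ l))))

    n≡ : n ≡ length l + suc (length r) + e
    n≡ = trans (sym sum≡) (trans (sum≡length+excess composition) (cong (_+ e) (length-++ l)))

    composition-l : IsComposition l
    composition-l = All.++⁻ˡ l composition

    composition-r : IsComposition r
    composition-r = tail (All.++⁻ʳ l composition)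

    1≤x′ : 1 ≤ x′
    1≤x′ = head (All.++⁻ʳ l composition′)

  -- Lowering x by k leaves a full-length subcomposition of size n − k, whose embedding into w′
  -- must be entrywise.
  lower-big : suc k ≤ x → Pointwise _≤_ r r′
  lower-big k<x =
    Pointwise.tail (Pointwise.++-cancelˡ l (Sublist.toPointwise same-length (inherit cv fits v≼w)))
    where
    v = l ++ (x ∸ k) ∷ r
    cv : IsComposition v
    cv = All.++⁺ composition-l (m<n⇒0<n∸m k<x ∷ composition-r)
    v≼w : v ≼ w
    v≼w = Sublist.++⁺ ≼-refl (m∸n≤m x k ∷ ≼-refl)
    same-length : length v ≡ length w′
    same-length = trans (trans (length-++ l) (sym (length-++ l))) (length-≡ n-large I)
    rearrange : ∀ a b c d → a + (b + c) + d ≡ a + ((b + d) + c)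
    rearrange = solve-∀
    fits : sum v + k ≤ n
    fits = ≤-reflexive (begin
      sum v + k                           ≡⟨ cong (_+ k) (sum-++ l (x ∸ k ∷ r)) ⟩
      sum l + (x ∸ k + sum r) + k         ≡⟨ rearrange (sum l) (x ∸ k) (sum r) k ⟩
      sum l + ((x ∸ k + k) + sum r)       ≡⟨ cong (λ y → sum l + (y + sum r)) (m∸n+n≡m (<⇒≤ k<x)) ⟩
      sum l + (x + sum r)                 ≡⟨ sym (sum-++ l (x ∷ r)) ⟩
      sum w                               ≡⟨ sum≡ ⟩
      n                                   ∎)
      where open ≡-Reasoning

  -- The probe 1…1 (s+1) 1…1 has full length, so it can only sit in w′ entrywise.
  threshold-large-excess : ∀ {s} → s + k ≤ e → suc s ≤ x → suc s ≤ x′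
  threshold-large-excess {s} large s<x = Pointwise.head (Sublist.toPointwise same-length
    (Sublist.++⁻ (length-replicate (length l)) (inherit cp fits p≼w)))
    where
    p = ones (length l) ++ suc s ∷ ones (length r)
    cp : IsComposition p
    cp = All.++⁺ (ones-composition _) (s≤s z≤n ∷ ones-composition _)
    p≼w : p ≼ w
    p≼w = Sublist.++⁺ (ones-≼ composition-l) (s<x ∷ ones-≼ composition-r)
    same-length : length (suc s ∷ ones (length r)) ≡ length (x′ ∷ r′)
    same-length = cong suc (trans (length-replicate (length r)) length-rest)
    rearrange : ∀ ll lr s k → ll + (suc s + lr) + k ≡ (ll + lr) + suc (s + k)
    rearrange = solve-∀
    rearrange′ : ∀ ll lr e → (ll + lr) + suc e ≡ ll + suc lr + e
    rearrange′ = solve-∀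
    fits : sum p + k ≤ n
    fits = begin
      sum p + k                                        ≡⟨ cong (_+ k) (sum-++ (ones (length l)) _) ⟩
      sum (ones (length l)) + (suc s + sum (ones (length r))) + k
                                                       ≡⟨ cong₂ (λ a b → a + (suc s + b) + k) (sum-ones _) (sum-ones _) ⟩
      length l + (suc s + length r) + k                ≡⟨ rearrange (length l) (length r) s k ⟩
      (length l + length r) + suc (s + k)              ≤⟨ +-monoʳ-≤ (length l + length r) (s≤s large) ⟩
      (length l + length r) + suc e                    ≡⟨ rearrange′ (length l) (length r) e ⟩
      length l + suc (length r) + e                    ≡⟨ sym n≡ ⟩
      n                                                ∎
      where open ≤-Reasoning

  private
    front-loaded back-loaded : ℕ → List ℕ
    front-loaded a = replicate (suc (count≥ a l)) a ++ ones (length r)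
    back-loaded  a = ones (length l) ++ 1 ∷ replicate (suc (count≥ a r)) a

    front-loaded-composition : ∀ {a} → 1 ≤ a → IsComposition (front-loaded a)
    front-loaded-composition 1≤a = All.++⁺ (All.replicate⁺ _ 1≤a) (ones-composition (length r))

    back-loaded-composition : ∀ {a} → 1 ≤ a → IsComposition (back-loaded a)
    back-loaded-composition 1≤a = All.++⁺ (ones-composition (length l)) (s≤s z≤n ∷ All.replicate⁺ _ 1≤a)

    sum-front-loaded : ∀ a → sum (front-loaded a) ≡ suc (count≥ a l) * a + length r
    sum-front-loaded a = trans (sum-++ (replicate (suc (count≥ a l)) a) _)
      (cong₂ _+_ (sum-replicate (suc (count≥ a l)) a) (sum-ones (length r)))

    sum-back-loaded : ∀ a → sum (back-loaded a) ≡ length l + (1 + suc (count≥ a r) * a)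
    sum-back-loaded a = trans (sum-++ (ones (length l)) _)
      (cong₂ (λ p q → p + (1 + q)) (sum-ones (length l)) (sum-replicate (suc (count≥ a r)) a))

    front-loaded-≼ : ∀ {a} → a ≤ x → front-loaded a ≼ w
    front-loaded-≼ {a} a≤x = subst (front-loaded a ≼_) (++-assoc l [ x ] r)
      (Sublist.++⁺ (count≥⇒replicate-≼ (≤-reflexive (sym count≥-l-x))) (ones-≼ composition-r))
      where
      count≥-l-x : count≥ a (l ++ [ x ]) ≡ suc (count≥ a l)
      count≥-l-x = trans (count≥-++ a l [ x ]) (trans (cong (_ +_) (count≥-accept [] a≤x)) (+-comm _ 1))

    front-loaded-⋠ : ∀ {a} → x′ < a → ¬ (front-loaded a ≼ w′)
    front-loaded-⋠ {a} x′<a P≼w′ = <-irrefl refl (subst (suc (count≥ a l) ≤_) count≥-l-x′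
      (replicate-≼⇒count≥ (Sublist-++⁻ʳ {bs = l ++ [ x′ ]} (trans (length-replicate (length r)) length-rest)
        (subst (_ ≼_) (sym (++-assoc l [ x′ ] r′)) P≼w′))))
      where
      count≥-l-x′ : count≥ a (l ++ [ x′ ]) ≡ count≥ a l
      count≥-l-x′ = trans (count≥-++ a l [ x′ ]) (trans (cong (_ +_) (count≥-reject [] x′<a)) (+-identityʳ _))

    back-loaded-≼ : ∀ {a} → count≥ a r < count≥ a r′ → back-loaded a ≼ w′
    back-loaded-≼ r<r′ = Sublist.++⁺ (ones-≼ composition-l) (1≤x′ ∷ count≥⇒replicate-≼ r<r′)

    back-loaded-⋠ : ∀ {a} → ¬ (back-loaded a ≼ w)
    back-loaded-⋠ P≼w =
      <-irrefl refl (replicate-≼⇒count≥ (Sublist.∷⁻ (Sublist.++⁻ (length-replicate (length l)) P≼w)))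

  -- front-loaded a lies in w but not in w′, back-loaded a lies in w′ (r′ has more entries ≥ a than r)
  -- but not in w, and their sizes add up to at most 2(n − k) + 1, so one of them is inherited.
  threshold-small-excess : ∀ {s} → 1 ≤ s → s ≤ k → e < s + k → suc s ≤ x → x′ < suc s → ⊥
  threshold-small-excess {s} 1≤s s≤k small s<x x′<a = Sum.[
      (λ fits → front-loaded-⋠ x′<a (inherit (front-loaded-composition (s≤s z≤n)) fits (front-loaded-≼ s<x)))
    , (λ fits → back-loaded-⋠ (inherit′ (back-loaded-composition (s≤s z≤n)) fits (back-loaded-≼ r<r′)))
    ] (≤-or-≤ one-fits)
    where
    a = suc s
    c  = count≥ a l
    cr = count≥ a r
    t≡ : count≥ a w ≡ c + suc cr
    t≡ = trans (count≥-++ a l (x ∷ r)) (cong (c +_) (count≥-accept r s<x))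
    r<r′ : cr < count≥ a r′
    r<r′ = +-cancelˡ-≤ c _ _ (subst₂ _≤_ t≡
      (trans (count≥-++ a l (x′ ∷ r′)) (cong (c +_) (count≥-reject r′ x′<a)))
      (count≥-≤ n-large I 1≤s s≤k small))
    rearrange : ∀ c cr a ll lr k → (suc c * a + lr + k) + (ll + (1 + suc cr * a) + k)
                                   ≡ (c + suc cr) * a + a + (ll + suc lr) + (k + k)
    rearrange = solve-∀
    one-fits : (sum (front-loaded a) + k) + (sum (back-loaded a) + k) ≤ suc (n + n)
    one-fits = begin
      (sum (front-loaded a) + k) + (sum (back-loaded a) + k)
        ≡⟨ cong₂ (λ p q → (p + k) + (q + k)) (sum-front-loaded a) (sum-back-loaded a) ⟩
      (suc c * a + length r + k) + (length l + (1 + suc cr * a) + k)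
        ≡⟨ rearrange c cr a (length l) (length r) k ⟩
      (c + suc cr) * a + a + (length l + suc (length r)) + (k + k)
        ≡⟨ cong (λ t → t * a + a + (length l + suc (length r)) + (k + k)) (sym t≡) ⟩
      count≥ a w * a + a + (length l + suc (length r)) + (k + k)
        ≤⟨ pair-fits {s} {k} {count≥ a w} (count-bound 1≤s s≤k (excess-count≥ s w) small) (excess-count≥ s w)
                     (subst (3 * k + 1 ≤_) n≡ n-large) ⟩
      suc ((length l + suc (length r) + e) + (length l + suc (length r) + e))
        ≡⟨ cong (λ m → suc (m + m)) (sym n≡) ⟩
      suc (n + n) ∎
      where open ≤-Reasoning

  threshold-preserved : ∀ {s} → 1 ≤ s → s ≤ k → suc s ≤ x → suc s ≤ x′
  threshold-preserved {s} 1≤s s≤k s<x with s + k ≤? e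
  ... | yes large = threshold-large-excess large s<x
  ... | no small  = ≮⇒≥ (threshold-small-excess 1≤s s≤k (≰⇒> small) s<x)

no-descent : ∀ {k n l x r x′ r′} → 3 * k + 1 ≤ n →
             Indistinguishable k n (l ++ x ∷ r) (l ++ x′ ∷ r′) → x′ < x → ⊥
no-descent {k} {n} {l} {x} {r} {x′} {r′} n-large I x′<x with x′ ≤? k
... | yes x′≤k = <-irrefl refl
      (threshold-preserved n-large I (head (All.++⁻ʳ l composition′)) x′≤k x′<x)
  where open Indistinguishable I
... | no x′≰k = <-irrefl (sym x≡x′) x′<x
  where
  open Indistinguishable I
  r≡r′ : r ≡ r′
  r≡r′ = Pointwise-≡⇒≡ (Pointwise.antisymmetric ≤-antisym
    (lower-big n-large I (≤-trans (≰⇒> x′≰k) (<⇒≤ x′<x))) (lower-big n-large (swap I) (≰⇒> x′≰k)))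
  x≡x′ : x ≡ x′
  x≡x′ = +-cancelʳ-≡ (sum r) x x′ (+-cancelˡ-≡ (sum l) _ _ (begin
    sum l + (x + sum r)   ≡⟨ sym (sum-++ l (x ∷ r)) ⟩
    sum (l ++ x ∷ r)      ≡⟨ trans sum≡ (sym sum≡′) ⟩
    sum (l ++ x′ ∷ r′)    ≡⟨ sum-++ l (x′ ∷ r′) ⟩
    sum l + (x′ + sum r′) ≡⟨ cong (λ t → sum l + (x′ + sum t)) (sym r≡r′) ⟩
    sum l + (x′ + sum r)  ∎))
    where open ≡-Reasoning

reconstruct : ∀ {k n w w′} → 3 * k + 1 ≤ n → Indistinguishable k n w w′ → w′ ≡ w
reconstruct {w = w} {w′} n-large I with ≡-or-divergence _≟_ w w′ (length-≡ n-large I)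
... | inj₁ w≡w′ = sym w≡w′
... | inj₂ (diverge l x x′ r r′ x≢x′ refl refl) with <-cmp x x′
...   | tri< x<x′ _ _ = ⊥-elim (no-descent n-large (swap I) x<x′)
...   | tri≈ _ x≡x′ _ = ⊥-elim (x≢x′ x≡x′)
...   | tri> _ _ x′<x = ⊥-elim (no-descent n-large I x′<x)

theorem1 : (k n : ℕ) → 3 * k + 1 ≤ n →
    (w w′ : List ℕ) → IsComposition w → sum w ≡ n → IsComposition w′ →
    ((u : List ℕ) → (DelK k w u → DelK k w′ u) × (DelK k w′ u → DelK k w u)) →
    w′ ≡ w
theorem1 k n n-large w w′ cw sw cw′ H =
  reconstruct n-large (same-deletions⇒indistinguishable k≤n cw sw cw′ H)
  where
  k≤n : k ≤ n
  k≤n = ≤-trans (m≤n*m k 3) (≤-trans (m≤m+n (3 * k) 1) n-large)
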